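{- Let $d\in\mathbb N$, let $S\subseteq V_d$ and $E\subseteq\{0,\dots,d\}$ be nonempty subsets of the same size, and let $A^{(d)}_{E,S}=\left(\binom{d-\deg(i,j)}{a-i}\right)_{a\in E,(i,j)\in S}$. Let $w\in\mathbb Z^{V_d}$ be an outcome with $\mathrm{supp}(w)\subseteq S$. If $A^{(d)}_{E,S}$ is invertible, then $w$ is the zero configuration.
   Context: $V_d=\{(i,j)\in\mathbb Z_{\geq0}^2\mid i+j\leq d\}$, $\deg(i,j)=i+j$; binomial coefficients $\binom{n}{k}$ with $n\geq 0$ are $0$ if $k<0$ or $k>n$. A chip configuration is $w\in\mathbb Z^{V_d}$. A splitting move at $p\in V_{d-1}$ decreases $w_p$ by $1$ and increases $w_{p+(1,0)}$, $w_{p+(0,1)}$ by $1$; an unsplitting move is its inverse; an outcome is a configuration reachable from the zero configuration by finitely many moves. $\mathrm{supp}(w)=\{(i,j)\mid w_{i,j}\neq0\}$. -}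

module Defs where

open import Data.Nat as ℕ using (ℕ; zero; suc; _≤_; _<_; _<ᵇ_)
open import Data.Nat.Combinatorics using (_C_)
open import Data.Integer as ℤ using (ℤ; +_)
open import Data.Rational as ℚ using (ℚ; 0ℚ; 1ℚ)
open import Data.Product using (_×_; _,_; ∃)
open import Data.Fin using (Fin)
open import Data.Vec using (Vec; lookup)
open import Data.Bool using (if_then_else_)
open import Relation.Nullary.Decidable using (⌊_⌋)
open import Data.Product.Properties using (≡-dec)
open import Relation.Binary.PropositionalEquality using (_≡_; _≢_)

-- chip configurations on V_d, represented as functions ℕ → ℕ → ℤ
-- (outcomes automatically vanish outside V_d)
Config : Set
Config = ℕ → ℕ → ℤ

zeroConfig : Config
zeroConfig _ _ = + 0

δ : ℕ → ℕ → ℕ → ℕ → ℤ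
δ a b i j = if ⌊ ≡-dec ℕ._≟_ ℕ._≟_ (a , b) (i , j) ⌋ then + 1 else + 0

split : ℕ → ℕ → Config → Config
split i j w a b = w a b ℤ.- δ a b i j ℤ.+ δ a b (suc i) j ℤ.+ δ a b i (suc j)

unsplit : ℕ → ℕ → Config → Config
unsplit i j w a b = w a b ℤ.+ δ a b i j ℤ.- δ a b (suc i) j ℤ.- δ a b i (suc j)

data Outcome (d : ℕ) : Config → Set where
  start   : Outcome d zeroConfig
  splitM   : ∀ {w} (i j : ℕ) → suc (i ℕ.+ j) ≤ d → Outcome d w → Outcome d (split i j w)
  unsplitM : ∀ {w} (i j : ℕ) → suc (i ℕ.+ j) ≤ d → Outcome d w → Outcome d (unsplit i j w)

-- binomial coefficient binom(d - deg(i,j), a - i), zero when a - i < 0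
-- (for (i,j) ∈ V_d, d ∸ (i+j) is the true difference; _C_ is 0 when k > n)
entry : ℕ → ℕ → ℕ → ℕ → ℕ
entry d a i j = if a <ᵇ i then 0 else (d ℕ.∸ (i ℕ.+ j)) C (a ℕ.∸ i)

Amat : (d : ℕ) {n : ℕ} → Vec ℕ n → Vec (ℕ × ℕ) n → Fin n → Fin n → ℚ
Amat d E S k l with lookup S l
... | (i , j) = (+ entry d (lookup E k) i j) ℚ./ 1

sumFin : (n : ℕ) → (Fin n → ℚ) → ℚ
sumFin zero f = 0ℚ
sumFin (suc n) f = f Data.Fin.zero ℚ.+ sumFin n (λ k → f (Data.Fin.suc k))


Matrix : ℕ → Set
Matrix n = Fin n → Fin n → ℚ

_⊗_ : {n : ℕ} → Matrix n → Matrix n → Matrix n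
_⊗_ {n} A B k l = sumFin n (λ m → A k m ℚ.* B m l)

identity : {n : ℕ} → Matrix n
identity k l = if ⌊ k Data.Fin.≟ l ⌋ then 1ℚ else 0ℚ

Invertible : {n : ℕ} → Matrix n → Set
Invertible {n} A = ∃ λ (B : Matrix n) → (∀ k l → (A ⊗ B) k l ≡ identity k l) × (∀ k l → (B ⊗ A) k l ≡ identity k l)

SuppIn : {n : ℕ} → Config → Vec (ℕ × ℕ) n → Set
SuppIn {n} w S = ∀ i j → w i j ≢ + 0 → ∃ λ (l : Fin n) → lookup S l ≡ (i , j)

-- For each a, pair a configuration w with the weights c_a(i, j) = binom(d - i - j, a - i).
-- A split at p replaces c_a(p) by c_a(p + (1,0)) + c_a(p + (0,1)), which is Pascal's rule
-- for the binomial coefficient, so splitting and unsplitting leave every pairing unchanged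
-- and every outcome pairs to zero with every c_a.  If w is supported on S, its pairing with
-- c_a for a ∈ E is the a-th entry of A_{E,S} applied to (w_s)_{s ∈ S}; a left inverse of
-- A_{E,S} then kills that vector, so w vanishes.
module Submission where

open import Algebra.Bundles using (Semiring; CommutativeRing)
open import Data.Fin using (punchIn)
open import Data.Fin.Properties using (punchInᵢ≢i)
open import Data.Nat using (suc)
open import Data.Vec.Functional using (Vector; removeAt)
open import Relation.Binary.PropositionalEquality using (_≢_)

module SemiringSum {c ℓ} (R : Semiring c ℓ) where
  open Semiring R
  open import Algebra.Properties.Semiring.Sum R public
  open import Relation.Binary.Reasoning.Setoid setoid

  sum-zero : ∀ {n} (t : Vector Carrier n) → (∀ k → t k ≈ 0#) → sum t ≈ 0#
  sum-zero {n} t t≈0 = begin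
    sum t                ≈⟨ sum-cong-≋ t≈0 ⟩
    sum {n} (λ _ → 0#)   ≈⟨ sum-replicate-zero n ⟩
    0#                   ∎

  sum-single : ∀ {n} (t : Vector Carrier n) i → (∀ k → k ≢ i → t k ≈ 0#) → sum t ≈ t i
  sum-single {suc n} t i off = begin
    sum t                      ≈⟨ sum-remove {i = i} t ⟩
    t i + sum (removeAt t i)   ≈⟨ +-congˡ (sum-zero _ (λ k → off (punchIn i k) (punchInᵢ≢i i k))) ⟩
    t i + 0#                   ≈⟨ +-identityʳ (t i) ⟩
    t i                        ∎

open import Defs
open import Data.Bool using (if_then_else_)
open import Data.Empty using (⊥-elim)
open import Data.Fin as Fin using (Fin; toℕ; fromℕ<)
import Data.Fin.Properties as FinP
open import Data.Integer as ℤ using (ℤ; +_; 0ℤ; 1ℤ; -1ℤ; _*_; -_)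
import Data.Integer.Properties as ℤP
open import Algebra.Properties.CommutativeSemigroup ℤP.*-commutativeSemigroup using (x∙yz≈y∙xz)
open import Data.Integer.Tactic.RingSolver using (solve-∀)
open import Data.Nat as ℕ using (ℕ; zero; _≤_; _<_; _+_; _∸_; _<ᵇ_; s≤s)
import Data.Nat.Properties as ℕP
open import Data.Nat.Combinatorics using (_C_; nCk+nC[k+1]≡[n+1]C[k+1])
open import Data.Product using (_×_; _,_; proj₁; proj₂)
open import Data.Product.Properties using (≡-dec)
open import Data.Rational as ℚ using (ℚ; 0ℚ; 1ℚ)
import Data.Rational.Properties as ℚP
open import Data.Rational.Unnormalised as ℚᵘ using (mkℚᵘ; *≡*; _≃_)
import Data.Rational.Unnormalised.Properties as ℚᵘP
open import Data.Vec using (Vec; lookup)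
open import Function using (_∘_)
open import Relation.Binary.PropositionalEquality
  using (_≡_; refl; sym; trans; cong; cong₂; subst; module ≡-Reasoning)
open import Relation.Nullary using (Dec; yes; no)
open import Relation.Nullary.Decidable using (decidable-stable)

module ℤ∑ = SemiringSum ℤP.+-*-semiring
module ℚ∑ = SemiringSum (CommutativeRing.semiring ℚP.+-*-commutativeRing)
open ℤ∑ using (sum-syntax)

point : ℕ × ℕ → Config
point s a b = δ a b (proj₁ s) (proj₂ s)

_at_ : (ℕ → ℕ → ℤ) → ℕ × ℕ → ℤ
f at s = f (proj₁ s) (proj₂ s)

point-self : ∀ s → point s at s ≡ 1ℤ
point-self s with ≡-dec ℕ._≟_ ℕ._≟_ s s
... | yes _   = refl
... | no s≢s = ⊥-elim (s≢s refl)

point-off : ∀ {s t} → s ≢ t → point t at s ≡ 0ℤ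
point-off {s} {t} s≢t with ≡-dec ℕ._≟_ ℕ._≟_ s t
... | yes s≡t = ⊥-elim (s≢t s≡t)
... | no _    = refl

point-sift : ∀ (f : ℕ → ℕ → ℤ) s t → f at t * point t at s ≡ f at s * point t at s
point-sift f s t with ≡-dec ℕ._≟_ ℕ._≟_ s t
... | yes refl = refl
... | no _     = trans (ℤP.*-zeroʳ (f at t)) (sym (ℤP.*-zeroʳ (f at s)))

-- Summing over the square [0,d]² instead of V_d is harmless: moves at points of V_{d-1}
-- and the support S only involve points of V_d.
box : ℕ → (ℕ → ℕ → ℤ) → ℤ
box d f = ∑[ p < suc d ] ∑[ q < suc d ] f (toℕ p) (toℕ q)

module _ (d : ℕ) where
  private
    entries : (ℕ → ℕ → ℤ) → Fin (suc d) → Fin (suc d) → ℤ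
    entries f p q = f (toℕ p) (toℕ q)

  box-cong : ∀ {f g : ℕ → ℕ → ℤ} → (∀ p q → f p q ≡ g p q) → box d f ≡ box d g
  box-cong f≗g =
    ℤ∑.sum-cong-≋ {suc d} (λ p → ℤ∑.sum-cong-≋ {suc d} (λ q → f≗g (toℕ p) (toℕ q)))

  box-+ : ∀ (f g : ℕ → ℕ → ℤ) → box d (λ p q → f p q ℤ.+ g p q) ≡ box d f ℤ.+ box d g
  box-+ f g =
    trans (ℤ∑.sum-cong-≋ (λ p → ℤ∑.∑-distrib-+ (entries f p) (entries g p)))
          (ℤ∑.∑-distrib-+ (λ p → ℤ∑.sum (entries f p)) (λ p → ℤ∑.sum (entries g p)))

  box-*ˡ : ∀ x (f : ℕ → ℕ → ℤ) → box d (λ p q → x * f p q) ≡ x * box d f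
  box-*ˡ x f = sym
    (trans (ℤ∑.*-distribˡ-sum x (λ p → ℤ∑.sum (entries f p)))
           (ℤ∑.sum-cong-≋ (λ p → ℤ∑.*-distribˡ-sum x (entries f p))))

  box-∑ : ∀ {n} (f : Fin n → ℕ → ℕ → ℤ) →
          box d (λ p q → ∑[ l < n ] f l p q) ≡ ∑[ l < n ] box d (f l)
  box-∑ f = trans (ℤ∑.sum-cong-≋ (λ p → ℤ∑.∑-comm (λ q l → entries (f l) p q)))
                  (ℤ∑.∑-comm (λ p l → ℤ∑.sum (entries (f l) p)))

sum-single-toℕ : ∀ {n} (t : ℕ → ℤ) {i} → i < n →
                 (∀ k → k ≢ i → t k ≡ 0ℤ) → ∑[ k < n ] t (toℕ k) ≡ t i
sum-single-toℕ t {i} i<n off =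
  trans (ℤ∑.sum-single _ (fromℕ< i<n) (λ k k≢i → off (toℕ k) (toℕ≢i k≢i)))
        (cong t (FinP.toℕ-fromℕ< i<n))
  where
  toℕ≢i : ∀ {k} → k ≢ fromℕ< i<n → toℕ k ≢ i
  toℕ≢i k≢i k≡i = k≢i (FinP.toℕ-injective (trans k≡i (sym (FinP.toℕ-fromℕ< i<n))))

box-single : ∀ d {f : ℕ → ℕ → ℤ} i j → i + j ≤ d →
             (∀ p q → (p , q) ≢ (i , j) → f p q ≡ 0ℤ) → box d f ≡ f i j
box-single d {f} i j i+j≤d off =
  trans (sum-single-toℕ (λ p → ∑[ q < suc d ] f p (toℕ q)) (s≤s (ℕP.m+n≤o⇒m≤o i i+j≤d)) row-zero)
        (sum-single-toℕ (f i) (s≤s (ℕP.m+n≤o⇒n≤o i i+j≤d)) (λ q q≢j → off i q (q≢j ∘ cong proj₂)))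
  where
  row-zero : ∀ p → p ≢ i → ∑[ q < suc d ] f p (toℕ q) ≡ 0ℤ
  row-zero p p≢i =
    ℤ∑.sum-zero {suc d} (λ q → f p (toℕ q)) (λ q → off p (toℕ q) (p≢i ∘ cong proj₁))

pairing : ℕ → (ℕ → ℕ → ℤ) → Config → ℤ
pairing d c w = box d (λ p q → c p q * w p q)

Pascal : ℕ → (ℕ → ℕ → ℤ) → Set
Pascal d c = ∀ i j → suc (i + j) ≤ d → c i j ≡ c (suc i) j ℤ.+ c i (suc j)

i+j<d⇒i+[1+j]≤d : ∀ {i j d} → suc (i + j) ≤ d → i + suc j ≤ d
i+j<d⇒i+[1+j]≤d {i} {j} {d} = subst (_≤ d) (sym (ℕP.+-suc i j))

module _ (d : ℕ) (c : ℕ → ℕ → ℤ) where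
  open ≡-Reasoning

  pairing-cong : ∀ {w u : Config} → (∀ p q → w p q ≡ u p q) → pairing d c w ≡ pairing d c u
  pairing-cong w≗u = box-cong d (λ p q → cong (c p q *_) (w≗u p q))

  pairing-zeroConfig : pairing d c zeroConfig ≡ 0ℤ
  pairing-zeroConfig = trans (box-cong d (λ p q → ℤP.*-zeroʳ (c p q))) (box-*ˡ d 0ℤ (λ _ _ → 0ℤ))

  pairing-+ : ∀ w u → pairing d c (λ p q → w p q ℤ.+ u p q) ≡ pairing d c w ℤ.+ pairing d c u
  pairing-+ w u = trans (box-cong d (λ p q → ℤP.*-distribˡ-+ (c p q) (w p q) (u p q)))
                        (box-+ d (λ p q → c p q * w p q) (λ p q → c p q * u p q))

  pairing-*ˡ : ∀ x w → pairing d c (λ p q → x * w p q) ≡ x * pairing d c w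
  pairing-*ˡ x w = trans (box-cong d (λ p q → x∙yz≈y∙xz (c p q) x (w p q)))
                         (box-*ˡ d x (λ p q → c p q * w p q))

  pairing-neg : ∀ w → pairing d c (λ p q → - w p q) ≡ - pairing d c w
  pairing-neg w = begin
    pairing d c (λ p q → - w p q)       ≡⟨ pairing-cong (λ p q → ℤP.-1*i≡-i (w p q)) ⟨
    pairing d c (λ p q → -1ℤ * w p q)   ≡⟨ pairing-*ˡ -1ℤ w ⟩
    -1ℤ * pairing d c w                 ≡⟨ ℤP.-1*i≡-i (pairing d c w) ⟩
    - pairing d c w                     ∎

  pairing-- : ∀ w u → pairing d c (λ p q → w p q ℤ.- u p q) ≡ pairing d c w ℤ.- pairing d c u
  pairing-- w u = trans (pairing-+ w (λ p q → - u p q)) (cong (ℤ._+_ (pairing d c w)) (pairing-neg u))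

  pairing-point : ∀ i j → i + j ≤ d → pairing d c (point (i , j)) ≡ c i j
  pairing-point i j i+j≤d = begin
    pairing d c (point (i , j))        ≡⟨ box-single d i j i+j≤d off ⟩
    c i j * point (i , j) at (i , j)   ≡⟨ cong (c i j *_) (point-self (i , j)) ⟩
    c i j * 1ℤ                         ≡⟨ ℤP.*-identityʳ (c i j) ⟩
    c i j                              ∎
    where
    off : ∀ p q → (p , q) ≢ (i , j) → c p q * point (i , j) p q ≡ 0ℤ
    off p q pq≢ij = trans (cong (c p q *_) (point-off pq≢ij)) (ℤP.*-zeroʳ (c p q))

  pairing-∑ : ∀ {n} (f : Fin n → Config) →
              pairing d c (λ p q → ∑[ l < n ] f l p q) ≡ ∑[ l < n ] pairing d c (f l)
  pairing-∑ {n} f = trans (box-cong d (λ p q → ℤ∑.*-distribˡ-sum {n} (c p q) (λ l → f l p q)))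
                          (box-∑ d (λ l p q → c p q * f l p q))

  pairing-split : ∀ i j w → suc (i + j) ≤ d →
    pairing d c (split i j w) ≡ pairing d c w ℤ.- c i j ℤ.+ c (suc i) j ℤ.+ c i (suc j)
  pairing-split i j w i+j<d = begin
    pairing d c (split i j w)
      ≡⟨ pairing-+ w″ (point (i , suc j)) ⟩
    pairing d c w″ ℤ.+ pairing d c (point (i , suc j))
      ≡⟨ cong₂ ℤ._+_ (pairing-+ w′ (point (suc i , j)))
                     (pairing-point i (suc j) (i+j<d⇒i+[1+j]≤d i+j<d)) ⟩
    pairing d c w′ ℤ.+ pairing d c (point (suc i , j)) ℤ.+ c i (suc j)
      ≡⟨ cong₂ (λ x y → x ℤ.+ y ℤ.+ c i (suc j))
               (pairing-- w (point (i , j))) (pairing-point (suc i) j i+j<d) ⟩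
    pairing d c w ℤ.- pairing d c (point (i , j)) ℤ.+ c (suc i) j ℤ.+ c i (suc j)
      ≡⟨ cong (λ x → pairing d c w ℤ.- x ℤ.+ c (suc i) j ℤ.+ c i (suc j))
              (pairing-point i j (ℕP.<⇒≤ i+j<d)) ⟩
    pairing d c w ℤ.- c i j ℤ.+ c (suc i) j ℤ.+ c i (suc j)
      ∎
    where
    w′ w″ : Config
    w′ p q = w p q ℤ.- point (i , j) p q
    w″ p q = w′ p q ℤ.+ point (suc i , j) p q

  pairing-unsplit : ∀ i j w → suc (i + j) ≤ d →
    pairing d c (unsplit i j w) ≡ pairing d c w ℤ.+ c i j ℤ.- c (suc i) j ℤ.- c i (suc j)
  pairing-unsplit i j w i+j<d = begin
    pairing d c (unsplit i j w)
      ≡⟨ pairing-- w″ (point (i , suc j)) ⟩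
    pairing d c w″ ℤ.- pairing d c (point (i , suc j))
      ≡⟨ cong₂ ℤ._-_ (pairing-- w′ (point (suc i , j)))
                     (pairing-point i (suc j) (i+j<d⇒i+[1+j]≤d i+j<d)) ⟩
    pairing d c w′ ℤ.- pairing d c (point (suc i , j)) ℤ.- c i (suc j)
      ≡⟨ cong₂ (λ x y → x ℤ.- y ℤ.- c i (suc j))
               (pairing-+ w (point (i , j))) (pairing-point (suc i) j i+j<d) ⟩
    pairing d c w ℤ.+ pairing d c (point (i , j)) ℤ.- c (suc i) j ℤ.- c i (suc j)
      ≡⟨ cong (λ x → pairing d c w ℤ.+ x ℤ.- c (suc i) j ℤ.- c i (suc j))
              (pairing-point i j (ℕP.<⇒≤ i+j<d)) ⟩
    pairing d c w ℤ.+ c i j ℤ.- c (suc i) j ℤ.- c i (suc j)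
      ∎
    where
    w′ w″ : Config
    w′ p q = w p q ℤ.+ point (i , j) p q
    w″ p q = w′ p q ℤ.- point (suc i , j) p q

  module _ (pascal : Pascal d c) where

    pairing-split-invariant : ∀ i j w → suc (i + j) ≤ d → pairing d c (split i j w) ≡ pairing d c w
    pairing-split-invariant i j w i+j<d = begin
      pairing d c (split i j w)
        ≡⟨ pairing-split i j w i+j<d ⟩
      pairing d c w ℤ.- c i j ℤ.+ c (suc i) j ℤ.+ c i (suc j)
        ≡⟨ cong (λ x → pairing d c w ℤ.- x ℤ.+ c (suc i) j ℤ.+ c i (suc j)) (pascal i j i+j<d) ⟩
      pairing d c w ℤ.- (c (suc i) j ℤ.+ c i (suc j)) ℤ.+ c (suc i) j ℤ.+ c i (suc j)
        ≡⟨ x-[y+z]+y+z≡x (pairing d c w) (c (suc i) j) (c i (suc j)) ⟩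
      pairing d c w
        ∎
      where
      x-[y+z]+y+z≡x : ∀ x y z → x ℤ.- (y ℤ.+ z) ℤ.+ y ℤ.+ z ≡ x
      x-[y+z]+y+z≡x = solve-∀

    pairing-unsplit-invariant : ∀ i j w → suc (i + j) ≤ d → pairing d c (unsplit i j w) ≡ pairing d c w
    pairing-unsplit-invariant i j w i+j<d = begin
      pairing d c (unsplit i j w)
        ≡⟨ pairing-unsplit i j w i+j<d ⟩
      pairing d c w ℤ.+ c i j ℤ.- c (suc i) j ℤ.- c i (suc j)
        ≡⟨ cong (λ x → pairing d c w ℤ.+ x ℤ.- c (suc i) j ℤ.- c i (suc j)) (pascal i j i+j<d) ⟩
      pairing d c w ℤ.+ (c (suc i) j ℤ.+ c i (suc j)) ℤ.- c (suc i) j ℤ.- c i (suc j)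
        ≡⟨ x+[y+z]-y-z≡x (pairing d c w) (c (suc i) j) (c i (suc j)) ⟩
      pairing d c w
        ∎
      where
      x+[y+z]-y-z≡x : ∀ x y z → x ℤ.+ (y ℤ.+ z) ℤ.- y ℤ.- z ≡ x
      x+[y+z]-y-z≡x = solve-∀

    pairing-outcome : ∀ {w} → Outcome d w → pairing d c w ≡ 0ℤ
    pairing-outcome start                  = pairing-zeroConfig
    pairing-outcome (splitM {w} i j i+j<d o) =
      trans (pairing-split-invariant i j w i+j<d) (pairing-outcome o)
    pairing-outcome (unsplitM {w} i j i+j<d o) =
      trans (pairing-unsplit-invariant i j w i+j<d) (pairing-outcome o)

shiftedBinomial : ℕ → ℕ → ℕ → ℕ
shiftedBinomial n a i = if a <ᵇ i then 0 else n C (a ∸ i)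

shiftedBinomial-pascal : ∀ n a i →
  shiftedBinomial (suc n) a i ≡ shiftedBinomial n a (suc i) + shiftedBinomial n a i
shiftedBinomial-pascal n zero    zero    = refl
shiftedBinomial-pascal n (suc a) zero    = sym (nCk+nC[k+1]≡[n+1]C[k+1] n a)
shiftedBinomial-pascal n zero    (suc i) = refl
shiftedBinomial-pascal n (suc a) (suc i) = shiftedBinomial-pascal n a i

entry-pascal : ∀ d a i j → suc (i + j) ≤ d →
  entry d a i j ≡ entry d a (suc i) j + entry d a i (suc j)
entry-pascal d a i j i+j<d = begin
  entry d a i j
    ≡⟨⟩
  shiftedBinomial (d ∸ (i + j)) a i
    ≡⟨ cong (λ m → shiftedBinomial m a i) (ℕP.+-∸-assoc 1 i+j<d) ⟩
  shiftedBinomial (suc n) a i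
    ≡⟨ shiftedBinomial-pascal n a i ⟩
  shiftedBinomial n a (suc i) + shiftedBinomial n a i
    ≡⟨ cong (λ m → shiftedBinomial n a (suc i) + shiftedBinomial (d ∸ m) a i) (ℕP.+-suc i j) ⟨
  entry d a (suc i) j + entry d a i (suc j)
    ∎
  where
  open ≡-Reasoning
  n = d ∸ suc (i + j)

binomialWeight : ℕ → ℕ → ℕ → ℕ → ℤ
binomialWeight d a i j = + entry d a i j

binomialWeight-pascal : ∀ d a → Pascal d (binomialWeight d a)
binomialWeight-pascal d a i j i+j<d =
  trans (cong +_ (entry-pascal d a i j i+j<d)) (ℤP.pos-+ (entry d a (suc i) j) (entry d a i (suc j)))

module _ {n} (S : Vec (ℕ × ℕ) n) (S-injective : ∀ k l → lookup S k ≡ lookup S l → k ≡ l) where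
  open ≡-Reasoning

  point-count : ∀ m → ∑[ l < n ] point (lookup S l) at lookup S m ≡ 1ℤ
  point-count m =
    trans (ℤ∑.sum-single (λ l → point (lookup S l) at lookup S m) m
                         (λ l l≢m → point-off (λ Sm≡Sl → l≢m (S-injective l m (sym Sm≡Sl)))))
          (point-self (lookup S m))

  support-decomposition : ∀ {w} → SuppIn w S →
    ∀ a b → w a b ≡ ∑[ l < n ] (w at lookup S l * point (lookup S l) a b)
  support-decomposition {w} supp a b = begin
    w a b
      ≡⟨ counted-once (w a b ℤ.≟ 0ℤ) ⟩
    w a b * ∑[ l < n ] point (lookup S l) a b
      ≡⟨ ℤ∑.*-distribˡ-sum (w a b) (λ l → point (lookup S l) a b) ⟩
    ∑[ l < n ] (w a b * point (lookup S l) a b)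
      ≡⟨ ℤ∑.sum-cong-≋ (λ l → point-sift w (a , b) (lookup S l)) ⟨
    ∑[ l < n ] (w at lookup S l * point (lookup S l) a b)
      ∎
    where
    counted-once : Dec (w a b ≡ 0ℤ) → w a b ≡ w a b * ∑[ l < n ] point (lookup S l) a b
    counted-once (yes w≡0) = trans w≡0 (cong (_* _) (sym w≡0))
    counted-once (no w≢0) with supp a b w≢0
    ... | m , Sm≡ab = sym (begin
      w a b * ∑[ l < n ] point (lookup S l) a b
        ≡⟨ cong (w a b *_) (subst (λ s → ∑[ l < n ] point (lookup S l) at s ≡ 1ℤ) Sm≡ab
                                  (point-count m)) ⟩
      w a b * 1ℤ
        ≡⟨ ℤP.*-identityʳ (w a b) ⟩
      w a b
        ∎)

  pairing-supported : ∀ d c {w} → SuppIn w S → (∀ k i j → lookup S k ≡ (i , j) → i + j ≤ d) →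
    pairing d c w ≡ ∑[ l < n ] (c at lookup S l * w at lookup S l)
  pairing-supported d c {w} supp S⊆V = begin
    pairing d c w
      ≡⟨ pairing-cong d c (support-decomposition supp) ⟩
    pairing d c (λ a b → ∑[ l < n ] (w at lookup S l * point (lookup S l) a b))
      ≡⟨ pairing-∑ d c (λ l a b → w at lookup S l * point (lookup S l) a b) ⟩
    ∑[ l < n ] pairing d c (λ a b → w at lookup S l * point (lookup S l) a b)
      ≡⟨ ℤ∑.sum-cong-≋ (λ l → pairing-*ˡ d c (w at lookup S l) (point (lookup S l))) ⟩
    ∑[ l < n ] (w at lookup S l * pairing d c (point (lookup S l)))
      ≡⟨ ℤ∑.sum-cong-≋ (λ l → cong (w at lookup S l *_)
                                   (pairing-point d c _ _ (S⊆V l _ _ refl))) ⟩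
    ∑[ l < n ] (w at lookup S l * c at lookup S l)
      ≡⟨ ℤ∑.sum-cong-≋ (λ l → ℤP.*-comm (w at lookup S l) (c at lookup S l)) ⟩
    ∑[ l < n ] (c at lookup S l * w at lookup S l)
      ∎

supported-vanishing : ∀ {n w} {S : Vec (ℕ × ℕ) n} → SuppIn w S →
  (∀ l → w at lookup S l ≡ 0ℤ) → ∀ i j → w i j ≡ 0ℤ
supported-vanishing {w = w} supp vanish i j = decidable-stable (w i j ℤ.≟ 0ℤ) λ w≢0 →
  let (l , Sl≡ij) = supp i j w≢0 in w≢0 (subst (λ s → w at s ≡ 0ℤ) Sl≡ij (vanish l))

ι : ℤ → ℚ
ι z = z ℚ./ 1

module _ where
  open import Relation.Binary.Reasoning.Setoid ℚᵘP.≃-setoid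

  toℚᵘ-ι : ∀ z → ℚ.toℚᵘ (ι z) ≃ mkℚᵘ z 0
  toℚᵘ-ι z = ℚP.toℚᵘ-fromℚᵘ (mkℚᵘ z 0)

  ι-+ : ∀ x y → ι (x ℤ.+ y) ≡ ι x ℚ.+ ι y
  ι-+ x y = ℚP.toℚᵘ-injective (begin
    ℚ.toℚᵘ (ι (x ℤ.+ y))             ≈⟨ toℚᵘ-ι (x ℤ.+ y) ⟩
    mkℚᵘ (x ℤ.+ y) 0                 ≈⟨ *≡* (cong (_* + 1) x*1+y*1≡x+y) ⟨
    mkℚᵘ x 0 ℚᵘ.+ mkℚᵘ y 0           ≈⟨ ℚᵘP.+-cong (toℚᵘ-ι x) (toℚᵘ-ι y) ⟨
    ℚ.toℚᵘ (ι x) ℚᵘ.+ ℚ.toℚᵘ (ι y)   ≈⟨ ℚP.toℚᵘ-homo-+ (ι x) (ι y) ⟨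
    ℚ.toℚᵘ (ι x ℚ.+ ι y)             ∎)
    where
    x*1+y*1≡x+y : x * + 1 ℤ.+ y * + 1 ≡ x ℤ.+ y
    x*1+y*1≡x+y = cong₂ ℤ._+_ (ℤP.*-identityʳ x) (ℤP.*-identityʳ y)

  ι-* : ∀ x y → ι (x * y) ≡ ι x ℚ.* ι y
  ι-* x y = ℚP.toℚᵘ-injective (begin
    ℚ.toℚᵘ (ι (x * y))               ≈⟨ toℚᵘ-ι (x * y) ⟩
    mkℚᵘ x 0 ℚᵘ.* mkℚᵘ y 0           ≈⟨ ℚᵘP.*-cong (toℚᵘ-ι x) (toℚᵘ-ι y) ⟨
    ℚ.toℚᵘ (ι x) ℚᵘ.* ℚ.toℚᵘ (ι y)   ≈⟨ ℚP.toℚᵘ-homo-* (ι x) (ι y) ⟨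
    ℚ.toℚᵘ (ι x ℚ.* ι y)             ∎)

  ι-injective : ∀ {x y} → ι x ≡ ι y → x ≡ y
  ι-injective {x} {y} ιx≡ιy with begin
    mkℚᵘ x 0       ≈⟨ toℚᵘ-ι x ⟨
    ℚ.toℚᵘ (ι x)   ≈⟨ ℚP.toℚᵘ-cong ιx≡ιy ⟩
    ℚ.toℚᵘ (ι y)   ≈⟨ toℚᵘ-ι y ⟩
    mkℚᵘ y 0       ∎
  ... | *≡* x*1≡y*1 = trans (sym (ℤP.*-identityʳ x)) (trans x*1≡y*1 (ℤP.*-identityʳ y))

ι-sum : ∀ {n} (f : Fin n → ℤ) → ι (ℤ∑.sum f) ≡ ℚ∑.sum (λ l → ι (f l))
ι-sum {zero}  f = refl
ι-sum {suc n} f =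
  trans (ι-+ (f Fin.zero) _) (cong (ℚ._+_ (ι (f Fin.zero))) (ι-sum (λ l → f (Fin.suc l))))

_·_ : ∀ {n} → Matrix n → (Fin n → ℚ) → Fin n → ℚ
_·_ {n} A x k = ℚ∑.sum {n} (λ l → A k l ℚ.* x l)

sumFin≡sum : ∀ n (f : Fin n → ℚ) → sumFin n f ≡ ℚ∑.sum f
sumFin≡sum zero    f = refl
sumFin≡sum (suc n) f = cong (ℚ._+_ (f Fin.zero)) (sumFin≡sum n (λ l → f (Fin.suc l)))

ι-· : ∀ {n} (a : Fin n → Fin n → ℤ) (x : Fin n → ℤ) k →
      ((λ k l → ι (a k l)) · (λ l → ι (x l))) k ≡ ι (∑[ l < n ] (a k l * x l))
ι-· a x k =
  trans (ℚ∑.sum-cong-≋ (λ l → sym (ι-* (a k l) (x l)))) (sym (ι-sum (λ l → a k l * x l)))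

module _ {n : ℕ} where
  open ≡-Reasoning

  identity-· : ∀ (x : Fin n → ℚ) m → (identity · x) m ≡ x m
  identity-· x m = begin
    (identity · x) m       ≡⟨ ℚ∑.sum-single (λ k → identity m k ℚ.* x k) m off-diagonal ⟩
    identity m m ℚ.* x m   ≡⟨ cong (ℚ._* x m) diagonal ⟩
    1ℚ ℚ.* x m             ≡⟨ ℚP.*-identityˡ (x m) ⟩
    x m                    ∎
    where
    diagonal : identity m m ≡ 1ℚ
    diagonal with m Fin.≟ m
    ... | yes _   = refl
    ... | no m≢m = ⊥-elim (m≢m refl)
    off-diagonal : ∀ k → k ≢ m → identity m k ℚ.* x k ≡ 0ℚ
    off-diagonal k k≢m with m Fin.≟ k
    ... | yes m≡k = ⊥-elim (k≢m (sym m≡k))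
    ... | no _    = ℚP.*-zeroˡ (x k)

  ⊗-·-assoc : ∀ (B A : Matrix n) x m → ((B ⊗ A) · x) m ≡ (B · (A · x)) m
  ⊗-·-assoc B A x m = begin
    ℚ∑.sum (λ k → (B ⊗ A) m k ℚ.* x k)
      ≡⟨ ℚ∑.sum-cong-≋ (λ k → cong (ℚ._* x k) (sumFin≡sum n (λ l → B m l ℚ.* A l k))) ⟩
    ℚ∑.sum (λ k → ℚ∑.sum (λ l → B m l ℚ.* A l k) ℚ.* x k)
      ≡⟨ ℚ∑.sum-cong-≋ (λ k → ℚ∑.*-distribʳ-sum (x k) (λ l → B m l ℚ.* A l k)) ⟩
    ℚ∑.sum (λ k → ℚ∑.sum (λ l → B m l ℚ.* A l k ℚ.* x k))
      ≡⟨ ℚ∑.∑-comm (λ k l → B m l ℚ.* A l k ℚ.* x k) ⟩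
    ℚ∑.sum (λ l → ℚ∑.sum (λ k → B m l ℚ.* A l k ℚ.* x k))
      ≡⟨ ℚ∑.sum-cong-≋ (λ l → ℚ∑.sum-cong-≋ (λ k → ℚP.*-assoc (B m l) (A l k) (x k))) ⟩
    ℚ∑.sum (λ l → ℚ∑.sum (λ k → B m l ℚ.* (A l k ℚ.* x k)))
      ≡⟨ ℚ∑.sum-cong-≋ (λ l → ℚ∑.*-distribˡ-sum (B m l) (λ k → A l k ℚ.* x k)) ⟨
    ℚ∑.sum (λ l → B m l ℚ.* (A · x) l)
      ∎

  left-invertible⇒trivial-kernel : ∀ (B A : Matrix n) → (∀ k l → (B ⊗ A) k l ≡ identity k l) →
    ∀ x → (∀ k → (A · x) k ≡ 0ℚ) → ∀ m → x m ≡ 0ℚ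
  left-invertible⇒trivial-kernel B A BA≡I x Ax≡0 m = begin
    x m                ≡⟨ identity-· x m ⟨
    (identity · x) m   ≡⟨ ℚ∑.sum-cong-≋ (λ k → cong (ℚ._* x k) (BA≡I m k)) ⟨
    ((B ⊗ A) · x) m    ≡⟨ ⊗-·-assoc B A x m ⟩
    (B · (A · x)) m    ≡⟨ ℚ∑.sum-zero (λ l → B m l ℚ.* (A · x) l) B·0≡0 ⟩
    0ℚ                 ∎
    where
    B·0≡0 : ∀ l → B m l ℚ.* (A · x) l ≡ 0ℚ
    B·0≡0 l = trans (cong (B m l ℚ.*_) (Ax≡0 l)) (ℚP.*-zeroʳ (B m l))

proposition5p2 : (d n : ℕ) → 1 ≤ n
    → (E : Vec ℕ n) → (∀ k l → lookup E k ≡ lookup E l → k ≡ l) → (∀ k → lookup E k ≤ d)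
    → (S : Vec (ℕ × ℕ) n) → (∀ k l → lookup S k ≡ lookup S l → k ≡ l)
    → (∀ k i j → lookup S k ≡ (i , j) → i + j ≤ d)
    → (w : Config) → Outcome d w → SuppIn w S
    → Invertible (Amat d E S)
    → ∀ i j → w i j ≡ + 0
proposition5p2 d n _ E _ _ S S-injective S⊆V w outcome supp (B , _ , BA≡I) =
  supported-vanishing {S = S} supp x≡0
  where
  open ≡-Reasoning
  x : Fin n → ℤ
  x l = w at lookup S l
  weight : Fin n → ℕ → ℕ → ℤ
  weight k = binomialWeight d (lookup E k)
  Ax≡0 : ∀ k → (Amat d E S · (λ l → ι (x l))) k ≡ 0ℚ
  Ax≡0 k = begin
    (Amat d E S · (λ l → ι (x l))) k
      ≡⟨ ι-· (λ k l → weight k at lookup S l) x k ⟩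
    ι (∑[ l < n ] (weight k at lookup S l * x l))
      ≡⟨ cong ι (pairing-supported S S-injective d (weight k) supp S⊆V) ⟨
    ι (pairing d (weight k) w)
      ≡⟨ cong ι (pairing-outcome d (weight k) (binomialWeight-pascal d (lookup E k)) outcome) ⟩
    ι 0ℤ
      ∎
  x≡0 : ∀ l → x l ≡ 0ℤ
  x≡0 l = ι-injective
    (left-invertible⇒trivial-kernel B (Amat d E S) BA≡I (λ l → ι (x l)) Ax≡0 l)
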